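{- For all integers $\sigma \ge 0$ and $n \ge 0$, $$G_\sigma(n) = \sum_{k=n}^{(\sigma+1)n} S_2^{(\sigma+1)}(k,n).$$
   Context: Gift exchange game with steal limit $\sigma\ge 0$ and $m\ge 1$ gifts: there are $m$ players and $m$ distinct wrapped gifts, initially all in a pool. The players are called one at a time in a fixed order. When a player is called, and also whenever a player's gift has just been stolen, that player (who currently holds no gift) makes a move: either take one of the gifts still in the pool (it is unwrapped and held by that player), or steal an unwrapped gift currently held by another player, provided this gift has so far been stolen fewer than $\sigma$ times in total; the player from whom it was stolen then immediately makes a move. The game ends as soon as the last gift in the pool is taken. A scenario is the complete sequence of moves (which player took which gift at each move). For $n\ge 0$, $G_\sigma(n)$ is the number of scenarios of the game with $m=n+1$ gifts in which the gifts are taken from the pool in the order $1,2,\ldots,n+1$ (equivalently, $1/(n+1)!$ times the total number of scenarios). For $h\ge1$, $S_2^{(h)}(k,n)$ denotes the number of partitions of the set $\{1,\ldots,k\}$ into exactly $n$ nonempty blocks, each of size at most $h$ (with $S_2^{(h)}(0,0)=1$). -}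

module Defs where

open import Data.Nat using (ℕ; zero; suc; _+_; _*_; _∸_; _<?_; _≤?_)
open import Data.Fin using (Fin) renaming (_≟_ to _≟F_)
open import Data.Bool using (Bool; true; false; if_then_else_)
open import Data.Maybe using (Maybe; just; nothing)
open import Data.Nat.ListAction using (sum)
open import Data.Bool.ListAction using (any; all)
open import Data.List using (List; []; _∷_; map; concatMap; filter; length;
  applyUpTo; deduplicate; mapMaybe)
open import Data.List.Properties using (≡-dec)
open import Data.Vec using (Vec; toList) renaming ([] to []ᵥ; _∷_ to _∷ᵥ_)
open import Data.Fin using (zero; suc)
open import Relation.Nullary using (yes; no; does)
open import Data.Product using (_×_; _,_)

allFin : (m : ℕ) → List (Fin m)
allFin zero = []
allFin (suc m) = zero ∷ map suc (allFin m)

update : {A : Set} {m : ℕ} → (Fin m → A) → Fin m → A → Fin m → A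
update f g x h = if does (h ≟F g) then x else f h

-- f a + f (a+1) + … + f b   (empty sum if b < a)
sumFromTo : ℕ → ℕ → (ℕ → ℕ) → ℕ
sumFromTo a b f = sum (applyUpTo (λ i → f (a + i)) (suc b ∸ a))

-- The gift exchange game with steal limit σ and m gifts / m players.
-- Players and gifts are both Fin m.  Players are called in the fixed
-- order 0,1,…,m-1.

-- A move: which player took which gift, and whether from the pool
-- (the tag is determined by the history: it is redundant information).
data Move (m : ℕ) : Set where
  fromPool : (player gift : Fin m) → Move m
  steal    : (player gift : Fin m) → Move m

record State (m : ℕ) : Set where
  field
    holder  : Fin m → Maybe (Fin m)   -- nothing = gift still wrapped in the pool
    stolen  : Fin m → ℕ
    active  : Fin m                   -- the player (holding no gift) to move
    pending : List (Fin m)            -- players not yet called, in calling order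
open State

poolNonEmpty : {m : ℕ} → (Fin m → Maybe (Fin m)) → Bool
poolNonEmpty {m} h = any isNothing (allFin m)
  where
  isNothing : _ → Bool
  isNothing g with h g
  ... | nothing = true
  ... | just _  = false

scenarios : (σ : ℕ) {m : ℕ} → ℕ → State m → List (List (Move m))
scenarios σ zero s = []
scenarios σ {m} (suc fuel) s = concatMap moveWith (allFin m)
  where
  a = active s
  moveWith : Fin m → List (List (Move m))
  moveWith g with holder s g
  ... | nothing =
    let h' = update (holder s) g (just a) in
    if poolNonEmpty h'
      then (case-pending (pending s) h')
      else ((fromPool a g ∷ []) ∷ [])
    where
    case-pending : List (Fin m) → (Fin m → Maybe (Fin m)) → List (List (Move m))
    case-pending [] h' = []   -- unreachable
    case-pending (p ∷ ps) h' =
      map (fromPool a g ∷_)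
        (scenarios σ fuel record { holder = h' ; stolen = stolen s
                                 ; active = p ; pending = ps })
  ... | just v =
    if does (v ≟F a) then []
    else if does (stolen s g <? σ)
      then map (steal a g ∷_)
             (scenarios σ fuel record
                { holder = update (holder s) g (just a)
                ; stolen = update (stolen s) g (suc (stolen s g))
                ; active = v ; pending = pending s })
      else []

initState : (m : ℕ) → State (suc m)
initState m = record { holder = λ _ → nothing ; stolen = λ _ → 0
                     ; active = zero ; pending = map suc (allFin m) }

-- every scenario has at most m takes and m·σ steals, so fuel m·(σ+1) suffices
allScenarios : (σ m : ℕ) → List (List (Move (suc m)))
allScenarios σ m = scenarios σ (suc m * suc σ) (initState m)

poolOrder : {m : ℕ} → List (Move m) → List (Fin m)
poolOrder = mapMaybe f
  where
  f : _ → _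
  f (fromPool _ g) = just g
  f (steal _ _)    = nothing

-- G_σ(n): number of scenarios with n+1 gifts in which the gifts are taken
-- from the pool in the order 1,2,…,n+1 (here 0,1,…,n)
G : (σ n : ℕ) → ℕ
G σ n = length (filter (λ sc → ≡-dec _≟F_ (poolOrder sc) (allFin (suc n)))
                       (allScenarios σ n))

-- A partition of {1,…,k} into exactly n blocks is encoded canonically as a
-- block-label vector f : Vec (Fin n) k whose labels appear for the first
-- time in the order 0,1,…,n-1 (blocks numbered by their least element);
-- this is a bijection between such vectors and set partitions into n blocks.

allVecs : (k n : ℕ) → List (Vec (Fin n) k)
allVecs zero n = []ᵥ ∷ []
allVecs (suc k) n = concatMap (λ v → map (_∷ᵥ v) (allFin n)) (allVecs k n)

blockSize : {k n : ℕ} → Vec (Fin n) k → Fin n → ℕ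
blockSize f j = length (filter (λ i → i ≟F j) (toList f))

isPartitionCode : (h : ℕ) {k n : ℕ} → Vec (Fin n) k → Bool
isPartitionCode h {k} {n} f =
  does (≡-dec _≟F_ (deduplicate _≟F_ (toList f)) (allFin n))
  Data.Bool.∧ all (λ j → does (blockSize f j ≤? h)) (allFin n)

S2 : (h k n : ℕ) → ℕ
S2 h k n = length (filter (λ f → isPartitionCode h f Data.Bool.≟ true) (allVecs k n))

-- Drop the final move of a scenario (taking the last gift) and record every other move by the
-- gift it moves; these gifts are n letters. A gift taken from the pool is always the next wrapped
-- one, so the word is a restricted growth word, and each letter occurs at most σ + 1 times: one
-- take and at most σ steals. Conversely each such word is replayed by exactly one scenario, since
-- the player to move and the holders are determined by the history and no holder is ever the
-- player to move. Restricted growth words of length k on n letters encode the partitions of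
-- {1,…,k} into n blocks, the occurrence bound is the block size bound, and only lengths
-- n ≤ k ≤ (σ + 1) n occur.
module Submission where

open import Defs
open import Data.Nat using (ℕ; suc; _*_)
open import Relation.Binary.PropositionalEquality using (_≡_)

open import Data.Nat using (zero; _+_; _∸_; _≤_; _<_; z≤n; s≤s; s≤s⁻¹)
import Data.Nat.Properties as ℕ
open import Data.Nat.Properties using (+-0-commutativeMonoid)
open import Data.Nat.ListAction using (sum)
open import Data.Nat.ListAction.Properties using (sum-++)
open import Data.Nat.Tactic.RingSolver using (solve-∀)
open import Algebra.Properties.CommutativeMonoid.Sum +-0-commutativeMonoid
  using (sum-syntax; ∑-distrib-+; sum-cong-≗; sum-replicate-zero; sum-init-last)
open import Data.Fin using (Fin; zero; suc; toℕ; inject₁; fromℕ) renaming (_≟_ to _≟ᶠ_)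
import Data.Fin.Properties as Fin
open import Data.Fin.Properties using (toℕ-injective; toℕ<n; inject₁-injective; toℕ-inject₁)
open import Data.Bool using (Bool; true; false; T)
import Data.Bool as Bool
open import Data.Bool.Properties using (T-∧; T-≡; ¬-not)
open import Data.Bool.ListAction using (or)
open import Data.Maybe using (Maybe; just; nothing)
open import Data.Maybe.Properties using (just-injective)
open import Data.Product using (_×_; _,_; proj₁; proj₂; ∃-syntax)
open import Data.Unit using (tt)
open import Data.List
  using (List; []; _∷_; _++_; map; concat; concatMap; filter; length; applyUpTo; drop; deduplicate)
open import Data.List.Properties
  using ( map-++; map-∘; map-cong; filter-accept; filter-reject; filter-all; length-filter
        ; length-deduplicate; ≡-dec; ∷-injectiveʳ; length-map; drop-map; length-drop)
open import Data.List.Membership.Propositional using (_∈_; _∉_)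
open import Data.List.Membership.Propositional.Properties using (∈-map⁺)
open import Data.List.Relation.Unary.Any using (here; there)
import Data.List.Relation.Unary.Any as Any
open import Data.List.Relation.Unary.Any.Properties using (any⁺; any⁻)
import Data.List.Relation.Unary.All as All
import Data.List.Relation.Unary.All.Properties as All
open import Data.List.Relation.Unary.All.Properties using (all⁺; all⁻; All¬⇒¬Any; ¬Any⇒All¬)
import Data.List.Relation.Unary.AllPairs as AllPairs
open import Data.List.Relation.Unary.Unique.Propositional using (Unique)
import Data.List.Relation.Unary.Unique.Propositional.Properties as Unique
open import Data.Vec using (Vec; toList) renaming (_∷_ to _∷ᵥ_)
open import Data.Vec.Properties using (length-toList)
open import Function using (_∘_)
open import Function.Bundles using (_⇔_; mk⇔; Equivalence)
open import Function.Construct.Composition using (_⇔-∘_)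
open import Function.Construct.Symmetry using (⇔-sym)
open import Level using (Level)
open import Relation.Binary.Definitions using (tri<; tri≈; tri>)
open import Relation.Binary.PropositionalEquality
open import Relation.Nullary using (Dec; does; ¬_; ¬?; yes; no; contradiction)
open import Relation.Nullary.Decidable using (T?; dec-true; dec-false; does-⇔)
open import Relation.Unary using (Pred; Decidable)

private variable
  p : Level
  A B : Set
  n : ℕ

fromBool : Bool → ℕ
fromBool true  = 1
fromBool false = 0

count : {P : Pred A p} → Decidable P → List A → ℕ
count P? xs = sum (map (λ x → fromBool (does (P? x))) xs)

module _ {P : Pred A p} (P? : Decidable P) where

  length-filter≡count : ∀ xs → length (filter P? xs) ≡ count P? xs
  length-filter≡count [] = refl
  length-filter≡count (x ∷ xs) with does (P? x)
  ... | true  = cong suc (length-filter≡count xs)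
  ... | false = length-filter≡count xs

  count-++ : ∀ xs ys → count P? (xs ++ ys) ≡ count P? xs + count P? ys
  count-++ xs ys = trans (cong sum (map-++ indicator xs ys)) (sum-++ (map indicator xs) (map indicator ys))
    where
    indicator : A → ℕ
    indicator x = fromBool (does (P? x))

  count-concatMap : ∀ (f : B → List A) xs → count P? (concatMap f xs) ≡ sum (map (count P? ∘ f) xs)
  count-concatMap f [] = refl
  count-concatMap f (x ∷ xs) =
    trans (count-++ (f x) (concatMap f xs)) (cong (count P? (f x) +_) (count-concatMap f xs))

  count-map : ∀ (f : B → A) xs → count P? (map f xs) ≡ count (P? ∘ f) xs
  count-map f xs = cong sum (sym (map-∘ xs))

  count-none : (∀ x → ¬ P x) → ∀ xs → count P? xs ≡ 0
  count-none ¬P [] = refl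
  count-none ¬P (x ∷ xs) rewrite dec-false (P? x) (¬P x) = count-none ¬P xs

count-T?-false : (xs : List A) → count (λ _ → T? false) xs ≡ 0
count-T?-false = count-none (λ _ → T? false) (λ _ ())

count-cong : {P Q : Pred A p} (P? : Decidable P) (Q? : Decidable Q) →
             (∀ x → P x ⇔ Q x) → ∀ xs → count P? xs ≡ count Q? xs
count-cong P? Q? P⇔Q xs = cong sum (map-cong (λ x → cong fromBool (does-⇔ (P⇔Q x) (P? x) (Q? x))) xs)

filter-filter : {P Q R : Pred A p} (P? : Decidable P) (Q? : Decidable Q) (R? : Decidable R) →
                (∀ {y} → R y ⇔ (P y × Q y)) → ∀ xs → filter P? (filter Q? xs) ≡ filter R? xs
filter-filter P? Q? R? R⇔PQ [] = refl
filter-filter P? Q? R? R⇔PQ (y ∷ ys) with Q? y | R? y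
... | yes qy | yes ry = trans (filter-accept P? (proj₁ (Equivalence.to R⇔PQ ry)))
                              (cong (y ∷_) (filter-filter P? Q? R? R⇔PQ ys))
... | yes qy | no ¬ry = trans (filter-reject P? (λ py → ¬ry (Equivalence.from R⇔PQ (py , qy))))
                              (filter-filter P? Q? R? R⇔PQ ys)
... | no ¬qy | yes ry = contradiction (proj₂ (Equivalence.to R⇔PQ ry)) ¬qy
... | no ¬qy | no ¬ry = filter-filter P? Q? R? R⇔PQ ys

T-does : {P : Set p} (P? : Dec P) → T (does P?) ⇔ P
T-does (yes p) = mk⇔ (λ _ → p) (λ _ → tt)
T-does (no ¬p) = mk⇔ (λ ()) ¬p

T-false⇔ : {P : Set p} → ¬ P → T false ⇔ P
T-false⇔ ¬P = mk⇔ (λ ()) ¬P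

sum-map-allFin : (f : Fin n → ℕ) → sum (map f (allFin n)) ≡ ∑[ i < n ] f i
sum-map-allFin {zero}  f = refl
sum-map-allFin {suc n} f = cong (f zero +_) (trans (cong sum (sym (map-∘ (allFin n)))) (sum-map-allFin (f ∘ suc)))

sum-map-∑ : (F : Fin n → A → ℕ) (xs : List A) →
            sum (map (λ x → ∑[ i < n ] F i x) xs) ≡ ∑[ i < n ] sum (map (F i) xs)
sum-map-∑ {n} F [] = sym (sum-replicate-zero n)
sum-map-∑ F (x ∷ xs) = trans (cong (∑[ i < _ ] F i x +_) (sum-map-∑ F xs)) (sym (∑-distrib-+ (λ i → F i x) _))

∑-≤-* : ∀ {c} (f : Fin n → ℕ) → (∀ i → f i ≤ c) → ∑[ i < n ] f i ≤ n * c
∑-≤-* {zero}  f f≤c = z≤n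
∑-≤-* {suc n} f f≤c = ℕ.+-mono-≤ (f≤c zero) (∑-≤-* (f ∘ suc) (f≤c ∘ suc))

sumBelow : ℕ → (ℕ → ℕ) → ℕ
sumBelow a g = sum (applyUpTo g a)

sumBelow-+ : ∀ a b (g : ℕ → ℕ) → sumBelow (a + b) g ≡ sumBelow a g + sumBelow b (λ i → g (a + i))
sumBelow-+ zero    b g = refl
sumBelow-+ (suc a) b g = trans (cong (g 0 +_) (sumBelow-+ a b (g ∘ suc))) (sym (ℕ.+-assoc (g 0) _ _))

sumBelow-cong : ∀ a {g h : ℕ → ℕ} → (∀ i → i < a → g i ≡ h i) → sumBelow a g ≡ sumBelow a h
sumBelow-cong zero    g≡h = refl
sumBelow-cong (suc a) g≡h = cong₂ _+_ (g≡h 0 (s≤s z≤n)) (sumBelow-cong a (λ i i<a → g≡h (suc i) (s≤s i<a)))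

sumBelow-zero : ∀ a {g : ℕ → ℕ} → (∀ i → i < a → g i ≡ 0) → sumBelow a g ≡ 0
sumBelow-zero zero    g≡0 = refl
sumBelow-zero (suc a) g≡0 = cong₂ _+_ (g≡0 0 (s≤s z≤n)) (sumBelow-zero a (λ i i<a → g≡0 (suc i) (s≤s i<a)))

∑-sumBelow : ∀ a (F : Fin n → ℕ → ℕ) → ∑[ i < n ] sumBelow a (F i) ≡ sumBelow a (λ k → ∑[ i < n ] F i k)
∑-sumBelow {n} zero    F = sum-replicate-zero n
∑-sumBelow     (suc a) F =
  trans (∑-distrib-+ (λ i → F i 0) _) (cong (∑[ i < _ ] F i 0 +_) (∑-sumBelow a (λ i → F i ∘ suc)))

sumBelow-support : ∀ a l r (g : ℕ → ℕ) → (∀ i → i < a → g i ≡ 0) → (∀ i → g (a + (l + i)) ≡ 0) →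
                   sumBelow (a + (l + r)) g ≡ sumBelow l (λ i → g (a + i))
sumBelow-support a l r g below above = begin
  sumBelow (a + (l + r)) g
    ≡⟨ sumBelow-+ a (l + r) g ⟩
  sumBelow a g + sumBelow (l + r) (λ i → g (a + i))
    ≡⟨ cong₂ _+_ (sumBelow-zero a below) (sumBelow-+ l r (λ i → g (a + i))) ⟩
  sumBelow l (λ i → g (a + i)) + sumBelow r (λ i → g (a + (l + i)))
    ≡⟨ cong (sumBelow l (λ i → g (a + i)) +_) (sumBelow-zero r (λ i _ → above i)) ⟩
  sumBelow l (λ i → g (a + i)) + 0
    ≡⟨ ℕ.+-comm _ 0 ⟩
  sumBelow l (λ i → g (a + i)) ∎
  where open ≡-Reasoning

∸≡suc : ∀ m k {c} → m ∸ k ≡ suc c → k < m × m ∸ suc k ≡ c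
∸≡suc (suc m) zero    eq = s≤s z≤n , ℕ.suc-injective eq
∸≡suc (suc m) (suc k) eq = let k<m , eq′ = ∸≡suc m k eq in s≤s k<m , eq′

update-same : (f : Fin n → A) (x : Fin n) (a : A) → update f x a x ≡ a
update-same f x a rewrite dec-true (x ≟ᶠ x) refl = refl

update-other : (f : Fin n → A) {x y : Fin n} (a : A) → y ≢ x → update f x a y ≡ f y
update-other f {x} {y} a y≢x rewrite dec-false (y ≟ᶠ x) y≢x = refl

∈-allFin : (j : Fin n) → j ∈ allFin n
∈-allFin zero    = here refl
∈-allFin (suc j) = there (∈-map⁺ suc (∈-allFin j))

length-allFin : ∀ n → length (allFin n) ≡ n
length-allFin zero    = refl
length-allFin (suc n) = cong suc (trans (length-map suc (allFin n)) (length-allFin n))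

allFin-unique : ∀ n → Unique (allFin n)
allFin-unique zero    = AllPairs.[]
allFin-unique (suc n) =
  All.map⁺ (All.universal (λ _ ()) (allFin n)) AllPairs.∷ Unique.map⁺ Fin.suc-injective (allFin-unique n)

toℕ-≤∧≢⇒< : ∀ {u} {x y : Fin n} → toℕ x ≡ u → toℕ y ≤ u → y ≢ x → toℕ y < u
toℕ-≤∧≢⇒< x≡u y≤u y≢x = ℕ.≤∧≢⇒< y≤u (λ y≡u → y≢x (toℕ-injective (trans y≡u (sym x≡u))))

drop-allFin-all : ∀ n → drop n (allFin n) ≡ []
drop-allFin-all zero    = refl
drop-allFin-all (suc n) = trans (drop-map n (allFin n)) (cong (map suc) (drop-allFin-all n))

drop-allFin : ∀ u (x : Fin n) → toℕ x ≡ u → drop u (allFin n) ≡ x ∷ drop (suc u) (allFin n)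
drop-allFin zero    zero    _  = refl
drop-allFin (suc u) (suc x) eq = begin
  drop u (map suc (allFin _))        ≡⟨ drop-map u (allFin _) ⟩
  map suc (drop u (allFin _))        ≡⟨ cong (map suc) (drop-allFin u x (ℕ.suc-injective eq)) ⟩
  suc x ∷ map suc (drop (suc u) (allFin _)) ≡⟨ cong (suc x ∷_) (drop-map (suc u) (allFin _)) ⟨
  suc x ∷ drop (suc u) (map suc (allFin _)) ∎
  where open ≡-Reasoning

drop-allFin-head : ∀ u {y : Fin n} {ys} → drop u (allFin n) ≡ y ∷ ys → toℕ y ≡ u
drop-allFin-head {suc n} zero    refl = refl
drop-allFin-head {suc n} (suc u) {y} {ys} eq =
  head-suc (drop u (allFin n)) refl (trans (sym (drop-map u (allFin n))) eq)
  where
  head-suc : ∀ xs → drop u (allFin n) ≡ xs → map suc xs ≡ y ∷ ys → toℕ y ≡ suc u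
  head-suc (z ∷ zs) d refl = cong suc (drop-allFin-head u d)

drop-allFin-length : ∀ u → length (drop u (allFin n)) ≡ n ∸ u
drop-allFin-length {n} u = trans (length-drop u (allFin n)) (cong (_∸ u) (length-allFin n))

count-≟-same : (x : Fin n) (w : List (Fin n)) → count (_≟ᶠ x) (x ∷ w) ≡ suc (count (_≟ᶠ x) w)
count-≟-same x w rewrite dec-true (x ≟ᶠ x) refl = refl

count-≟-other : {x j : Fin n} (w : List (Fin n)) → x ≢ j → count (_≟ᶠ j) (x ∷ w) ≡ count (_≟ᶠ j) w
count-≟-other {x = x} {j} w x≢j rewrite dec-false (x ≟ᶠ j) x≢j = refl

∑-indicator-≟ : (x : Fin n) → ∑[ j < n ] fromBool (does (x ≟ᶠ j)) ≡ 1
∑-indicator-≟ {suc n} zero    = cong suc (sum-replicate-zero n)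
∑-indicator-≟ {suc n} (suc x) = ∑-indicator-≟ x

∑-count-≟ : (w : List (Fin n)) → ∑[ j < n ] count (_≟ᶠ j) w ≡ length w
∑-count-≟ {n} []      = sum-replicate-zero n
∑-count-≟     (x ∷ w) = begin
  ∑[ j < _ ] (fromBool (does (x ≟ᶠ j)) + count (_≟ᶠ j) w)
    ≡⟨ ∑-distrib-+ (λ j → fromBool (does (x ≟ᶠ j))) _ ⟩
  ∑[ j < _ ] fromBool (does (x ≟ᶠ j)) + ∑[ j < _ ] count (_≟ᶠ j) w
    ≡⟨ cong₂ _+_ (∑-indicator-≟ x) (∑-count-≟ w) ⟩
  suc (length w) ∎
  where open ≡-Reasoning

-- Restricted growth words with capacities

-- State: the letters below u are in use, and letter j may occur r j more times.
accepts : ℕ → (Fin n → ℕ) → List (Fin n) → Bool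
accepts {n} u r [] = does (u ℕ.≟ n)
accepts u r (x ∷ w) with ℕ.<-cmp (toℕ x) u | r x
... | tri< _ _ _ | zero  = false
... | tri< _ _ _ | suc c = accepts u (update r x c) w
... | tri≈ _ _ _ | zero  = false
... | tri≈ _ _ _ | suc c = accepts (suc u) (update r x c) w
... | tri> _ _ _ | _     = false

newLetters : ℕ → List (Fin n) → List (Fin n)
newLetters u w = filter (λ y → u ℕ.≤? toℕ y) (deduplicate _≟ᶠ_ w)

record Admissible (u : ℕ) (r : Fin n → ℕ) (w : List (Fin n)) : Set where
  field
    inOrder     : newLetters u w ≡ drop u (allFin n)
    withinBound : ∀ j → count (_≟ᶠ j) w ≤ r j

open Admissible

newLetters-old : ∀ {u} {x : Fin n} w → toℕ x < u → newLetters u (x ∷ w) ≡ newLetters u w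
newLetters-old {u = u} {x} w x<u =
  trans (filter-reject (λ y → u ℕ.≤? toℕ y) (ℕ.<⇒≱ x<u))
        (filter-filter (λ y → u ℕ.≤? toℕ y) (λ y → ¬? (x ≟ᶠ y)) (λ y → u ℕ.≤? toℕ y)
           (mk⇔ (λ u≤y → u≤y , λ { refl → ℕ.<⇒≱ x<u u≤y }) proj₁) (deduplicate _≟ᶠ_ w))

newLetters-new : ∀ {u} {x : Fin n} w → toℕ x ≡ u → newLetters u (x ∷ w) ≡ x ∷ newLetters (suc u) w
newLetters-new {u = u} {x} w refl =
  trans (filter-accept (λ y → u ℕ.≤? toℕ y) ℕ.≤-refl)
        (cong (x ∷_) (filter-filter (λ y → u ℕ.≤? toℕ y) (λ y → ¬? (x ≟ᶠ y))
                                     (λ y → suc u ℕ.≤? toℕ y)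
           (mk⇔ (λ u<y → ℕ.<⇒≤ u<y , λ { refl → ℕ.<-irrefl refl u<y })
                (λ (u≤y , x≢y) → ℕ.≤∧≢⇒< u≤y (λ u≡y → x≢y (toℕ-injective u≡y))))
           (deduplicate _≟ᶠ_ w)))

withinBound-∷ : ∀ {r : Fin n → ℕ} {x c} w → r x ≡ suc c →
                (∀ j → count (_≟ᶠ j) (x ∷ w) ≤ r j) ⇔ (∀ j → count (_≟ᶠ j) w ≤ update r x c j)
withinBound-∷ {r = r} {x} {c} w rx≡1+c = mk⇔ to from
  where
  to : (∀ j → count (_≟ᶠ j) (x ∷ w) ≤ r j) → ∀ j → count (_≟ᶠ j) w ≤ update r x c j
  to bound j with j ≟ᶠ x
  ... | yes refl = s≤s⁻¹ (subst₂ _≤_ (count-≟-same x w) rx≡1+c (bound x))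
  ... | no j≢x   = subst (_≤ r j) (count-≟-other w (j≢x ∘ sym)) (bound j)
  from : (∀ j → count (_≟ᶠ j) w ≤ update r x c j) → ∀ j → count (_≟ᶠ j) (x ∷ w) ≤ r j
  from bound j with j ≟ᶠ x
  ... | yes refl = subst₂ _≤_ (sym (count-≟-same x w)) (sym rx≡1+c)
                     (s≤s (subst (count (_≟ᶠ x) w ≤_) (update-same r x c) (bound x)))
  ... | no j≢x = subst₂ _≤_ (sym (count-≟-other w (j≢x ∘ sym))) (update-other r c j≢x) (bound j)

admissible-[] : ∀ {u} {r : Fin n → ℕ} → u ≤ n → u ≡ n ⇔ Admissible u r []
admissible-[] {n} {u} u≤n = mk⇔ to from
  where
  to : u ≡ n → Admissible u _ []
  to refl = record { inOrder = sym (drop-allFin-all n) ; withinBound = λ _ → z≤n }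
  from : Admissible u _ [] → u ≡ n
  from adm = ℕ.≤-antisym u≤n
    (ℕ.m∸n≡0⇒m≤n (trans (sym (drop-allFin-length u)) (cong length (sym (inOrder adm)))))

admissible-old : ∀ {u} {r : Fin n → ℕ} {x c} w → toℕ x < u → r x ≡ suc c →
                 Admissible u r (x ∷ w) ⇔ Admissible u (update r x c) w
admissible-old w x<u rx≡1+c = mk⇔
  (λ adm → record { inOrder     = trans (sym (newLetters-old w x<u)) (inOrder adm)
                  ; withinBound = Equivalence.to (withinBound-∷ w rx≡1+c) (withinBound adm) })
  (λ adm → record { inOrder     = trans (newLetters-old w x<u) (inOrder adm)
                  ; withinBound = Equivalence.from (withinBound-∷ w rx≡1+c) (withinBound adm) })

admissible-new : ∀ {u} {r : Fin n → ℕ} {x c} w → toℕ x ≡ u → r x ≡ suc c →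
                 Admissible u r (x ∷ w) ⇔ Admissible (suc u) (update r x c) w
admissible-new {u = u} {x = x} w x≡u rx≡1+c = mk⇔
  (λ adm → record
    { inOrder     = ∷-injectiveʳ (trans (sym (newLetters-new w x≡u)) (trans (inOrder adm) (drop-allFin u x x≡u)))
    ; withinBound = Equivalence.to (withinBound-∷ w rx≡1+c) (withinBound adm) })
  (λ adm → record
    { inOrder     = trans (newLetters-new w x≡u) (trans (cong (x ∷_) (inOrder adm)) (sym (drop-allFin u x x≡u)))
    ; withinBound = Equivalence.from (withinBound-∷ w rx≡1+c) (withinBound adm) })

admissible-exhausted : ∀ {u} {r : Fin n → ℕ} {x} w → r x ≡ 0 → ¬ Admissible u r (x ∷ w)
admissible-exhausted {x = x} w rx≡0 adm with () ← subst₂ _≤_ (count-≟-same x w) rx≡0 (withinBound adm x)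

admissible-skip : ∀ {u} {r : Fin n → ℕ} {x} w → u < toℕ x → ¬ Admissible u r (x ∷ w)
admissible-skip {u = u} w u<x adm =
  ℕ.<-irrefl (sym (drop-allFin-head u
               (trans (sym (inOrder adm)) (filter-accept (λ y → u ℕ.≤? toℕ y) (ℕ.<⇒≤ u<x)))))
             u<x

accepts⇔admissible : ∀ {u} {r : Fin n → ℕ} w → u ≤ n → T (accepts u r w) ⇔ Admissible u r w
accepts⇔admissible {n} {u} [] u≤n = admissible-[] u≤n ⇔-∘ T-does (u ℕ.≟ n)
accepts⇔admissible {n} {u} {r} (x ∷ w) u≤n with ℕ.<-cmp (toℕ x) u | r x in rx
... | tri< _ _ _     | zero  = T-false⇔ (admissible-exhausted w rx)
... | tri< x<u _ _   | suc c = ⇔-sym (admissible-old w x<u rx) ⇔-∘ accepts⇔admissible w u≤n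
... | tri≈ _ _ _     | zero  = T-false⇔ (admissible-exhausted w rx)
... | tri≈ _ x≡u _   | suc c = ⇔-sym (admissible-new w x≡u rx) ⇔-∘ accepts⇔admissible w 1+u≤n
  where
  1+u≤n : suc u ≤ n
  1+u≤n = subst (_≤ n) (cong suc x≡u) (toℕ<n x)
... | tri> _ _ u<x   | _     = T-false⇔ (admissible-skip w u<x)

admissible-length-≥ : ∀ {u} {r : Fin n → ℕ} {w} → Admissible u r w → n ∸ u ≤ length w
admissible-length-≥ {n} {u} {w = w} adm = begin
  n ∸ u                                  ≡⟨ drop-allFin-length u ⟨
  length (drop u (allFin n))             ≡⟨ cong length (inOrder adm) ⟨
  length (newLetters u w)                ≤⟨ length-filter (λ y → u ℕ.≤? toℕ y) (deduplicate _≟ᶠ_ w) ⟩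
  length (deduplicate _≟ᶠ_ w)            ≤⟨ length-deduplicate _≟ᶠ_ w ⟩
  length w                               ∎
  where open ℕ.≤-Reasoning

admissible-length-≤ : ∀ {u c} {r : Fin n → ℕ} {w} → (∀ j → r j ≤ c) → Admissible u r w → length w ≤ n * c
admissible-length-≤ {w = w} r≤c adm =
  subst (_≤ _) (∑-count-≟ w)
        (∑-≤-* (λ j → count (_≟ᶠ j) w) (λ j → ℕ.≤-trans (withinBound adm j) (r≤c j)))

-- Partition codes

isPartitionCode⇔admissible : ∀ {k} h (f : Vec (Fin n) k) →
                             T (isPartitionCode h f) ⇔ Admissible 0 (λ _ → h) (toList f)
isPartitionCode⇔admissible {n} h f = mk⇔ to from
  where
  w : List (Fin n)
  w = toList f
  codes? : Dec (deduplicate _≟ᶠ_ w ≡ allFin n)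
  codes? = ≡-dec _≟ᶠ_ (deduplicate _≟ᶠ_ w) (allFin n)
  small : Fin n → Bool
  small j = does (blockSize f j ℕ.≤? h)
  newLetters-0 : newLetters 0 w ≡ deduplicate _≟ᶠ_ w
  newLetters-0 = filter-all (λ y → 0 ℕ.≤? toℕ y) (All.universal (λ _ → z≤n) _)
  to : T (isPartitionCode h f) → Admissible 0 (λ _ → h) w
  to pc with Equivalence.to T-∧ pc
  ... | codes , allSmall = record
    { inOrder     = trans newLetters-0 (Equivalence.to (T-does codes?) codes)
    ; withinBound = λ j → subst (_≤ h) (length-filter≡count (_≟ᶠ j) w)
                            (Equivalence.to (T-does (blockSize f j ℕ.≤? h))
                               (All.lookup (all⁺ small (allFin n) allSmall) (∈-allFin j))) }
  from : Admissible 0 (λ _ → h) w → T (isPartitionCode h f)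
  from adm = Equivalence.from T-∧
    ( Equivalence.from (T-does codes?) (trans (sym newLetters-0) (inOrder adm))
    , all⁻ small {xs = allFin n} (All.tabulate (λ {j} _ → Equivalence.from (T-does (blockSize f j ℕ.≤? h))
                                   (subst (_≤ h) (sym (length-filter≡count (_≟ᶠ j) w)) (withinBound adm j)))) )

acceptedWords : ℕ → ℕ → (Fin n → ℕ) → ℕ
acceptedWords {n} k u r = count (λ v → T? (accepts u r (toList v))) (allVecs k n)

acceptedWordsWithHead : ℕ → ℕ → (Fin n → ℕ) → Fin n → ℕ
acceptedWordsWithHead {n} k u r x = count (λ v → T? (accepts u r (x ∷ toList v))) (allVecs k n)

acceptedWords-suc : ∀ k u (r : Fin n → ℕ) → acceptedWords (suc k) u r ≡ ∑[ x < n ] acceptedWordsWithHead k u r x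
acceptedWords-suc {n} k u r = begin
  count accepted? (concatMap (λ v → map (_∷ᵥ v) (allFin n)) (allVecs k n))
    ≡⟨ count-concatMap accepted? (λ v → map (_∷ᵥ v) (allFin n)) (allVecs k n) ⟩
  sum (map (λ v → count accepted? (map (_∷ᵥ v) (allFin n))) (allVecs k n))
    ≡⟨ cong sum (map-cong (λ v → trans (count-map accepted? (_∷ᵥ v) (allFin n))
                                      (sum-map-allFin (λ x → indicator (x ∷ᵥ v)))) (allVecs k n)) ⟩
  sum (map (λ v → ∑[ x < n ] indicator (x ∷ᵥ v)) (allVecs k n))
    ≡⟨ sum-map-∑ (λ x v → indicator (x ∷ᵥ v)) (allVecs k n) ⟩
  ∑[ x < n ] acceptedWordsWithHead k u r x ∎
  where
  open ≡-Reasoning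
  accepted? : (v : Vec (Fin n) (suc k)) → Dec (T (accepts u r (toList v)))
  accepted? v = T? (accepts u r (toList v))
  indicator : Vec (Fin n) (suc k) → ℕ
  indicator v = fromBool (does (accepted? v))

S2≡acceptedWords : ∀ h k → S2 h k n ≡ acceptedWords k 0 (λ _ → h)
S2≡acceptedWords {n} h k =
  trans (length-filter≡count (λ f → isPartitionCode h f Bool.≟ true) (allVecs k n))
        (count-cong (λ f → isPartitionCode h f Bool.≟ true) (λ f → T? (accepts 0 (λ _ → h) (toList f)))
                    (λ f → ⇔-sym (accepts⇔admissible (toList f) z≤n)
                             ⇔-∘ (isPartitionCode⇔admissible h f ⇔-∘ ⇔-sym T-≡))
                    (allVecs k n))

acceptedWords-short : ∀ {k} (r : Fin n → ℕ) → k < n → acceptedWords k 0 r ≡ 0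
acceptedWords-short {n} {k} r k<n = count-none (λ v → T? (accepts 0 r (toList v))) rejected (allVecs k n)
  where
  rejected : (v : Vec (Fin n) k) → ¬ T (accepts 0 r (toList v))
  rejected v acc = ℕ.<⇒≱ k<n
    (subst (n ≤_) (length-toList v)
       (admissible-length-≥ (Equivalence.to (accepts⇔admissible (toList v) z≤n) acc)))

acceptedWords-long : ∀ {k c} (r : Fin n → ℕ) → (∀ j → r j ≤ c) → n * c < k → acceptedWords k 0 r ≡ 0
acceptedWords-long {n} {k} r r≤c nc<k = count-none (λ v → T? (accepts 0 r (toList v))) rejected (allVecs k n)
  where
  rejected : (v : Vec (Fin n) k) → ¬ T (accepts 0 r (toList v))
  rejected v acc = ℕ.<⇒≱ nc<k
    (subst (_≤ _) (length-toList v)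
       (admissible-length-≤ r≤c (Equivalence.to (accepts⇔admissible (toList v) z≤n) acc)))

-- The gift exchange game

-- Defs builds scenarios and poolNonEmpty by mapping local functions over allFin;
-- unifying with that shape gives those functions a name.
mappedFunction : ∀ {m} {C : Set} (fold : List B → C) {f : Fin m → B} (c : C) →
                 c ≡ fold (map f (allFin m)) → Fin m → B
mappedFunction _ {f} _ _ = f

isWrapped : ∀ {m} → (Fin m → Maybe (Fin m)) → Fin m → Bool
isWrapped h = mappedFunction or (poolNonEmpty h) refl

isWrapped-nothing : ∀ {m} (h : Fin m → Maybe (Fin m)) g → T (isWrapped h g) ⇔ h g ≡ nothing
isWrapped-nothing h g with h g
... | nothing = mk⇔ (λ _ → refl) (λ _ → tt)
... | just _  = mk⇔ (λ ()) (λ ())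

poolNonEmpty⇔ : ∀ {m} (h : Fin m → Maybe (Fin m)) → T (poolNonEmpty h) ⇔ (∃[ g ] h g ≡ nothing)
poolNonEmpty⇔ h = mk⇔
  (λ t → let g , wrapped = Any.satisfied (any⁻ (isWrapped h) (allFin _) t)
         in g , Equivalence.to (isWrapped-nothing h g) wrapped)
  (λ (g , hg) → any⁺ (isWrapped h)
                  (Any.map (λ { refl → Equivalence.from (isWrapped-nothing h g) hg }) (∈-allFin g)))

poolNonEmpty-true : ∀ {m} (h : Fin m → Maybe (Fin m)) g → h g ≡ nothing → poolNonEmpty h ≡ true
poolNonEmpty-true h g hg = Equivalence.to T-≡ (Equivalence.from (poolNonEmpty⇔ h) (g , hg))

poolNonEmpty-false : ∀ {m} (h : Fin m → Maybe (Fin m)) → (∀ g → h g ≢ nothing) → poolNonEmpty h ≡ false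
poolNonEmpty-false h unwrapped =
  ¬-not (λ e → let g , hg = Equivalence.to (poolNonEmpty⇔ h) (Equivalence.from T-≡ e) in unwrapped g hg)

module Game (σ n : ℕ) where

  open State

  Gift : Set
  Gift = Fin (suc n)

  branch : ℕ → State (suc n) → Gift → List (List (Move (suc n)))
  branch fuel s = mappedFunction concat (scenarios σ (suc fuel) s) refl

  matches : (u : ℕ) (sc : List (Move (suc n))) → Dec (poolOrder sc ≡ drop u (allFin (suc n)))
  matches u sc = ≡-dec _≟ᶠ_ (poolOrder sc) (drop u (allFin (suc n)))

  matching : ℕ → ℕ → State (suc n) → ℕ
  matching fuel u s = count (matches u) (scenarios σ fuel s)

  giveToActive : State (suc n) → Gift → Gift → Maybe Gift
  giveToActive s g = update (holder s) g (just (active s))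

  afterSteal : State (suc n) → Gift → Gift → State (suc n)
  afterSteal s g v = record { holder = giveToActive s g ; stolen = update (stolen s) g (suc (stolen s g))
                            ; active = v ; pending = pending s }

  afterTake : State (suc n) → Gift → Gift → List Gift → State (suc n)
  afterTake s g p ps = record { holder = giveToActive s g ; stolen = stolen s ; active = p ; pending = ps }

  branch-steal : ∀ {f u s g v} → holder s g ≡ just v → v ≢ active s → stolen s g < σ →
                 count (matches u) (branch f s g) ≡ matching f u (afterSteal s g v)
  branch-steal {f} {u} {s} {g} {v} hg v≢a st<σ
    rewrite hg | dec-false (v ≟ᶠ active s) v≢a | dec-true (stolen s g ℕ.<? σ) st<σ
    = count-map (matches u) (steal (active s) g ∷_) (scenarios σ f (afterSteal s g v))

  branch-steal-blocked : ∀ {f u s g v} → holder s g ≡ just v → σ ≤ stolen s g →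
                         count (matches u) (branch f s g) ≡ 0
  branch-steal-blocked {s = s} {g} {v} hg σ≤st
    rewrite hg | dec-false (stolen s g ℕ.<? σ) (ℕ.≤⇒≯ σ≤st) with v ≟ᶠ active s
  ... | yes _ = refl
  ... | no  _ = refl

  branch-take : ∀ {f u s g p ps} → holder s g ≡ nothing →
                drop u (allFin (suc n)) ≡ g ∷ drop (suc u) (allFin (suc n)) → poolNonEmpty (giveToActive s g) ≡ true → pending s ≡ p ∷ ps →
                count (matches u) (branch f s g) ≡ matching f (suc u) (afterTake s g p ps)
  branch-take {f} {u} {s} {g} {p} {ps} hg next nonEmpty ps≡ rewrite hg | nonEmpty | ps≡ =
    trans (count-map (matches u) (fromPool (active s) g ∷_) (scenarios σ f (afterTake s g p ps)))
          (count-cong (matches u ∘ (fromPool (active s) g ∷_)) (matches (suc u))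
             (λ sc → mk⇔ (λ e → ∷-injectiveʳ (trans e next)) (λ e → trans (cong (g ∷_) e) (sym next)))
             (scenarios σ f (afterTake s g p ps)))

  branch-take-last : ∀ {f u s g} → holder s g ≡ nothing → drop u (allFin (suc n)) ≡ g ∷ [] →
                     (∀ g′ → giveToActive s g g′ ≢ nothing) → count (matches u) (branch f s g) ≡ 1
  branch-take-last {u = u} {s} {g} hg last unwrapped
    rewrite hg | poolNonEmpty-false (giveToActive s g) unwrapped
          | dec-true (matches u (fromPool (active s) g ∷ [])) (sym last) = refl

  branch-take-early : ∀ {f u s g} → holder s g ≡ nothing → (∀ {ys} → drop u (allFin (suc n)) ≢ g ∷ ys) →
                      count (matches u) (branch f s g) ≡ 0
  branch-take-early {f} {u} {s} {g} hg notNext rewrite hg with poolNonEmpty (giveToActive s g)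
  ... | false rewrite dec-false (matches u (fromPool (active s) g ∷ [])) (notNext ∘ sym) = refl
  ... | true with pending s
  ...   | []     = refl
  ...   | p ∷ ps = trans (count-map (matches u) (fromPool (active s) g ∷_) (scenarios σ f (afterTake s g p ps)))
                         (count-none (matches u ∘ (fromPool (active s) g ∷_)) (λ sc → notNext ∘ sym)
                                     (scenarios σ f (afterTake s g p ps)))

  record Consistent (u : ℕ) (s : State (suc n)) : Set where
    field
      unwrapped       : ∀ g → toℕ g < u → holder s g ≢ nothing
      wrapped         : ∀ g → u ≤ toℕ g → holder s g ≡ nothing
      rolesDistinct   : Unique (active s ∷ pending s)
      holdersIdle     : ∀ {g v} → holder s g ≡ just v → v ∉ active s ∷ pending s
      holderInjective : ∀ {g g′ v} → holder s g ≡ just v → holder s g′ ≡ just v → g ≡ g′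
      pendingCount    : length (pending s) + u ≡ n

  open Consistent

  -- Capacity of gift x: the steals it has left, plus one while it is still wrapped.
  record RemainingCapacity (u : ℕ) (s : State (suc n)) (r : Fin n → ℕ) : Set where
    field
      takenCapacity   : ∀ x → toℕ x < u → r x ≡ σ ∸ stolen s (inject₁ x)
      wrappedCapacity : ∀ x → u ≤ toℕ x → r x ≡ suc (σ ∸ stolen s (inject₁ x))

  open RemainingCapacity

  giveToActive-injective : ∀ {u s g} → Consistent u s → ∀ {g₁ g₂ w} →
                           giveToActive s g g₁ ≡ just w → giveToActive s g g₂ ≡ just w → g₁ ≡ g₂
  giveToActive-injective {s = s} {g} c {g₁} {g₂} e₁ e₂ with g₁ ≟ᶠ g | g₂ ≟ᶠ g
  ... | yes refl | yes refl = refl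
  ... | yes refl | no _     = contradiction (here (sym (just-injective e₁))) (holdersIdle c e₂)
  ... | no _     | yes refl = contradiction (here (sym (just-injective e₂))) (holdersIdle c e₁)
  ... | no _     | no _     = holderInjective c e₁ e₂

  active∉pending : ∀ {u s} → Consistent u s → active s ∉ pending s
  active∉pending c with rolesDistinct c
  ... | AllPairs._∷_ a≢ps _ = All¬⇒¬Any a≢ps

  taken : ∀ {u s g v} → Consistent u s → holder s g ≡ just v → toℕ g < u
  taken c hg = ℕ.≰⇒> (λ u≤g → contradiction (trans (sym (wrapped c _ u≤g)) hg) λ ())

  consistent-steal : ∀ {u s g v} → Consistent u s → holder s g ≡ just v → Consistent u (afterSteal s g v)
  consistent-steal {u} {s} {g} {v} c hg = record
    { unwrapped       = unwrapped′
    ; wrapped         = wrapped′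
    ; rolesDistinct   = ¬Any⇒All¬ (pending s) (v∉ ∘ there) AllPairs.∷ AllPairs.tail (rolesDistinct c)
    ; holdersIdle     = idle′
    ; holderInjective = giveToActive-injective c
    ; pendingCount    = pendingCount c }
    where
    v∉ : v ∉ active s ∷ pending s
    v∉ = holdersIdle c hg
    unwrapped′ : ∀ g′ → toℕ g′ < u → giveToActive s g g′ ≢ nothing
    unwrapped′ g′ g′<u with g′ ≟ᶠ g
    ... | yes _ = λ ()
    ... | no _  = unwrapped c g′ g′<u
    wrapped′ : ∀ g′ → u ≤ toℕ g′ → giveToActive s g g′ ≡ nothing
    wrapped′ g′ u≤g′ with g′ ≟ᶠ g
    ... | yes refl = contradiction u≤g′ (ℕ.<⇒≱ (taken c hg))
    ... | no _     = wrapped c g′ u≤g′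
    idle′ : ∀ {g′ w} → giveToActive s g g′ ≡ just w → w ∉ v ∷ pending s
    idle′ {g′} e with g′ ≟ᶠ g
    idle′ refl | yes refl = λ { (here a≡v) → v∉ (here (sym a≡v)) ; (there a∈ps) → active∉pending c a∈ps }
    idle′ e | no g′≢g = λ { (here refl)  → g′≢g (holderInjective c e hg)
                          ; (there w∈ps) → holdersIdle c e (there w∈ps) }

  consistent-take : ∀ {u s g p ps} → Consistent u s → toℕ g ≡ u → pending s ≡ p ∷ ps →
                    Consistent (suc u) (afterTake s g p ps)
  consistent-take {u} {s} {g} {p} {ps} c g≡u ps≡ = record
    { unwrapped       = unwrapped′
    ; wrapped         = wrapped′
    ; rolesDistinct   = AllPairs.tail (subst (λ l → Unique (active s ∷ l)) ps≡ (rolesDistinct c))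
    ; holdersIdle     = idle′
    ; holderInjective = giveToActive-injective c
    ; pendingCount    = trans (ℕ.+-suc (length ps) u) (subst (λ l → length l + u ≡ n) ps≡ (pendingCount c)) }
    where
    unwrapped′ : ∀ g′ → toℕ g′ < suc u → giveToActive s g g′ ≢ nothing
    unwrapped′ g′ g′<1+u with g′ ≟ᶠ g
    ... | yes _    = λ ()
    ... | no g′≢g  = unwrapped c g′ (toℕ-≤∧≢⇒< g≡u (s≤s⁻¹ g′<1+u) g′≢g)
    wrapped′ : ∀ g′ → suc u ≤ toℕ g′ → giveToActive s g g′ ≡ nothing
    wrapped′ g′ u<g′ with g′ ≟ᶠ g
    ... | yes refl = contradiction g≡u (ℕ.<⇒≢ u<g′ ∘ sym)
    ... | no _     = wrapped c g′ (ℕ.<⇒≤ u<g′)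
    idle′ : ∀ {g′ w} → giveToActive s g g′ ≡ just w → w ∉ p ∷ ps
    idle′ {g′} e with g′ ≟ᶠ g
    idle′ refl | yes refl = subst (active s ∉_) ps≡ (active∉pending c)
    idle′ e    | no _     = subst (_ ∉_) ps≡ (holdersIdle c e ∘ there)

  consistent-init : Consistent 0 (initState n)
  consistent-init = record
    { unwrapped       = λ _ ()
    ; wrapped         = λ _ _ → refl
    ; rolesDistinct   = allFin-unique (suc n)
    ; holdersIdle     = λ ()
    ; holderInjective = λ ()
    ; pendingCount    = trans (ℕ.+-identityʳ _) (trans (length-map suc (allFin n)) (length-allFin n)) }

  capacity-steal : ∀ {u s r x c v} → RemainingCapacity u s r → toℕ x < u → r x ≡ suc c →
                   RemainingCapacity u (afterSteal s (inject₁ x) v) (update r x c)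
  capacity-steal {u} {s} {r} {x} {c} cap x<u rx = record { takenCapacity = taken′ ; wrappedCapacity = wrapped′ }
    where
    st : ℕ
    st = stolen s (inject₁ x)
    bump : Gift → ℕ
    bump = update (stolen s) (inject₁ x) (suc st)
    taken′ : ∀ y → toℕ y < u → update r x c y ≡ σ ∸ bump (inject₁ y)
    taken′ y y<u with y ≟ᶠ x
    ... | yes refl = trans (sym (proj₂ (∸≡suc σ st (trans (sym (takenCapacity cap x x<u)) rx))))
                           (cong (σ ∸_) (sym (update-same (stolen s) (inject₁ x) (suc st))))
    ... | no y≢x   = trans (takenCapacity cap y y<u)
                           (cong (σ ∸_) (sym (update-other (stolen s) (suc st) (y≢x ∘ inject₁-injective))))
    wrapped′ : ∀ y → u ≤ toℕ y → update r x c y ≡ suc (σ ∸ bump (inject₁ y))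
    wrapped′ y u≤y with y ≟ᶠ x
    ... | yes refl = contradiction u≤y (ℕ.<⇒≱ x<u)
    ... | no y≢x   = trans (wrappedCapacity cap y u≤y)
                           (cong (λ k → suc (σ ∸ k))
                                 (sym (update-other (stolen s) (suc st) (y≢x ∘ inject₁-injective))))

  capacity-take : ∀ {u s r x c p ps} → RemainingCapacity u s r → toℕ x ≡ u → r x ≡ suc c →
                  RemainingCapacity (suc u) (afterTake s (inject₁ x) p ps) (update r x c)
  capacity-take {u} {s} {r} {x} {c} cap x≡u rx = record { takenCapacity = taken′ ; wrappedCapacity = wrapped′ }
    where
    taken′ : ∀ y → toℕ y < suc u → update r x c y ≡ σ ∸ stolen s (inject₁ y)
    taken′ y y<1+u with y ≟ᶠ x
    ... | yes refl = ℕ.suc-injective (trans (sym rx) (wrappedCapacity cap x (ℕ.≤-reflexive (sym x≡u))))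
    ... | no y≢x   = takenCapacity cap y (toℕ-≤∧≢⇒< x≡u (s≤s⁻¹ y<1+u) y≢x)
    wrapped′ : ∀ y → suc u ≤ toℕ y → update r x c y ≡ suc (σ ∸ stolen s (inject₁ y))
    wrapped′ y u<y with y ≟ᶠ x
    ... | yes refl = contradiction x≡u (ℕ.<⇒≢ u<y ∘ sym)
    ... | no _     = wrappedCapacity cap y (ℕ.<⇒≤ u<y)

  capacity-init : RemainingCapacity 0 (initState n) (λ _ → suc σ)
  capacity-init = record { takenCapacity = λ _ () ; wrappedCapacity = λ _ _ → refl }

  -- The word of a scenario omits its final move, so it is shorter than the fuel.
  CountsAcceptedWords : ℕ → Set
  CountsAcceptedWords fuel = ∀ {u s r} → Consistent u s → RemainingCapacity u s r →
                             matching fuel u s ≡ sumBelow fuel (λ k → acceptedWords k u r)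

  holder-just : ∀ {u s g} → Consistent u s → toℕ g < u → ∃[ v ] holder s g ≡ just v
  holder-just {s = s} {g} c g<u with holder s g in hg
  ... | just v  = v , refl
  ... | nothing = contradiction hg (unwrapped c g g<u)

  pending-nonEmpty : ∀ {u s} → Consistent u s → u < n → ∃[ p ] ∃[ ps ] pending s ≡ p ∷ ps
  pending-nonEmpty {u} {s} c u<n with pending s | pendingCount c
  ... | []     | u≡n = contradiction u≡n (ℕ.<⇒≢ u<n)
  ... | p ∷ ps | _   = p , ps , refl

  branch-letter : ∀ {f} → CountsAcceptedWords f → ∀ {u s r} → Consistent u s → RemainingCapacity u s r →
                  ∀ x → count (matches u) (branch f s (inject₁ x)) ≡ sumBelow f (λ k → acceptedWordsWithHead k u r x)
  branch-letter {f} IH {u} {s} {r} c cap x with ℕ.<-cmp (toℕ x) u | r x in rx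
  ... | tri< x<u _ _ | zero   =
    let v , hg = holder-just c (subst (_< u) (sym (toℕ-inject₁ x)) x<u) in
    trans (branch-steal-blocked {f} {u} {s} hg (ℕ.m∸n≡0⇒m≤n (trans (sym (takenCapacity cap x x<u)) rx)))
          (sym (sumBelow-zero f (λ k _ → count-T?-false (allVecs k n))))
  ... | tri< x<u _ _ | suc c′ =
    let v , hg = holder-just c (subst (_< u) (sym (toℕ-inject₁ x)) x<u) in
    trans (branch-steal {f} {u} {s} hg (λ v≡a → holdersIdle c hg (here v≡a))
                        (proj₁ (∸≡suc σ _ (trans (sym (takenCapacity cap x x<u)) rx))))
          (IH (consistent-steal c hg) (capacity-steal cap x<u rx))
  ... | tri≈ _ x≡u _ | zero   = contradiction (trans (sym rx) (wrappedCapacity cap x (ℕ.≤-reflexive (sym x≡u)))) λ ()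
  ... | tri≈ _ x≡u _ | suc c′ =
    let p , ps , ps≡ = pending-nonEmpty c u<n in
    trans (branch-take {f} {u} {s} hg (drop-allFin u (inject₁ x) g≡u) (poolNonEmpty-true _ (fromℕ n) lastWrapped) ps≡)
          (IH (consistent-take c g≡u ps≡) (capacity-take cap x≡u rx))
    where
    g≡u : toℕ (inject₁ x) ≡ u
    g≡u = trans (toℕ-inject₁ x) x≡u
    u<n : u < n
    u<n = subst (_< n) x≡u (toℕ<n x)
    hg : holder s (inject₁ x) ≡ nothing
    hg = wrapped c (inject₁ x) (ℕ.≤-reflexive (sym g≡u))
    lastWrapped : giveToActive s (inject₁ x) (fromℕ n) ≡ nothing
    lastWrapped = trans (update-other (holder s) _ Fin.fromℕ≢inject₁)
                        (wrapped c (fromℕ n) (subst (u ≤_) (sym (Fin.toℕ-fromℕ n)) (ℕ.<⇒≤ u<n)))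
  ... | tri> _ _ u<x | _      =
    trans (branch-take-early {f} {u} {s} (wrapped c (inject₁ x) (ℕ.<⇒≤ u<g))
                             (λ next → ℕ.<⇒≢ u<g (sym (drop-allFin-head u next))))
          (sym (sumBelow-zero f (λ k _ → count-T?-false (allVecs k n))))
    where
    u<g : u < toℕ (inject₁ x)
    u<g = subst (u <_) (sym (toℕ-inject₁ x)) u<x

  branch-last : ∀ {f u s} (r : Fin n → ℕ) → Consistent u s →
                count (matches u) (branch f s (fromℕ n)) ≡ acceptedWords 0 u r
  branch-last {f} {u} {s} r c = trans (byLastTake (u ℕ.≟ n)) (sym (ℕ.+-identityʳ _))
    where
    lastWrapped : holder s (fromℕ n) ≡ nothing
    lastWrapped = wrapped c (fromℕ n)
                    (subst (u ≤_) (sym (Fin.toℕ-fromℕ n)) (subst (u ≤_) (pendingCount c) (ℕ.m≤n+m u _)))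
    byLastTake : (u≟n : Dec (u ≡ n)) → count (matches u) (branch f s (fromℕ n)) ≡ fromBool (does u≟n)
    byLastTake (yes u≡n) = branch-take-last {f} {u} {s} lastWrapped last unwrapped′
      where
      last : drop u (allFin (suc n)) ≡ fromℕ n ∷ []
      last = trans (drop-allFin u (fromℕ n) (trans (Fin.toℕ-fromℕ n) (sym u≡n)))
                   (cong (fromℕ n ∷_) (trans (cong (λ k → drop (suc k) (allFin (suc n))) u≡n)
                                             (drop-allFin-all (suc n))))
      unwrapped′ : ∀ g → giveToActive s (fromℕ n) g ≢ nothing
      unwrapped′ g with g ≟ᶠ fromℕ n
      ... | yes _ = λ ()
      ... | no g≢ = unwrapped c g (toℕ-≤∧≢⇒< (trans (Fin.toℕ-fromℕ n) (sym u≡n))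
                                              (subst (toℕ g ≤_) (sym u≡n) (s≤s⁻¹ (toℕ<n g))) g≢)
    byLastTake (no u≢n) = branch-take-early {f} {u} {s} lastWrapped
      (λ next → u≢n (trans (sym (drop-allFin-head u next)) (Fin.toℕ-fromℕ n)))

  count-scenarios : ∀ fuel → CountsAcceptedWords fuel
  count-scenarios zero    c cap = refl
  count-scenarios (suc f) {u} {s} {r} c cap = begin
    matching (suc f) u s
      ≡⟨ count-concatMap (matches u) (branch f s) (allFin (suc n)) ⟩
    sum (map (count (matches u) ∘ branch f s) (allFin (suc n)))
      ≡⟨ sum-map-allFin (count (matches u) ∘ branch f s) ⟩
    ∑[ g < suc n ] count (matches u) (branch f s g)
      ≡⟨ sum-init-last (count (matches u) ∘ branch f s) ⟩
    ∑[ x < n ] count (matches u) (branch f s (inject₁ x)) + count (matches u) (branch f s (fromℕ n))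
      ≡⟨ cong₂ _+_ (sum-cong-≗ (branch-letter (count-scenarios f) c cap)) (branch-last r c) ⟩
    ∑[ x < n ] sumBelow f (λ k → acceptedWordsWithHead k u r x) + acceptedWords 0 u r
      ≡⟨ ℕ.+-comm _ (acceptedWords 0 u r) ⟩
    acceptedWords 0 u r + ∑[ x < n ] sumBelow f (λ k → acceptedWordsWithHead k u r x)
      ≡⟨ cong (acceptedWords 0 u r +_) (∑-sumBelow f (λ x k → acceptedWordsWithHead k u r x)) ⟩
    acceptedWords 0 u r + sumBelow f (λ k → ∑[ x < n ] acceptedWordsWithHead k u r x)
      ≡⟨ cong (acceptedWords 0 u r +_) (sumBelow-cong f (λ k _ → sym (acceptedWords-suc k u r))) ⟩
    sumBelow (suc f) (λ k → acceptedWords k u r) ∎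
    where open ≡-Reasoning

fuel-split : ∀ σ n → suc n * suc σ ≡ n + (suc (σ * n) + σ)
fuel-split = solve-∀

sumFromTo≡sumBelow : ∀ a l (g : ℕ → ℕ) → sumFromTo a (a + l) g ≡ sumBelow (suc l) (λ i → g (a + i))
sumFromTo≡sumBelow a l g = cong (λ len → sumBelow len (λ i → g (a + i)))
  (trans (cong (_∸ a) (sym (ℕ.+-suc a l))) (ℕ.m+n∸m≡n a (suc l)))

n*[1+σ]<n+[1+σ*n+i] : ∀ σ n i → n * suc σ < n + (suc (σ * n) + i)
n*[1+σ]<n+[1+σ*n+i] σ n i = begin-strict
  n * suc σ                ≡⟨ ℕ.*-suc n σ ⟩
  n + n * σ                ≡⟨ cong (n +_) (ℕ.*-comm n σ) ⟩
  n + σ * n                <⟨ ℕ.+-monoʳ-< n (s≤s (ℕ.m≤m+n (σ * n) i)) ⟩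
  n + (suc (σ * n) + i)    ∎
  where open ℕ.≤-Reasoning

theorem1 : (σ n : ℕ) → G σ n ≡ sumFromTo n (suc σ * n) (λ k → S2 (suc σ) k n)
theorem1 σ n = begin
  G σ n
    ≡⟨ length-filter≡count (matches 0) (allScenarios σ n) ⟩
  matching (suc n * suc σ) 0 (initState n)
    ≡⟨ count-scenarios (suc n * suc σ) consistent-init capacity-init ⟩
  sumBelow (suc n * suc σ) words
    ≡⟨ cong (λ len → sumBelow len words) (fuel-split σ n) ⟩
  sumBelow (n + (suc (σ * n) + σ)) words
    ≡⟨ sumBelow-support n (suc (σ * n)) σ words (λ k → acceptedWords-short full)
                        (λ i → acceptedWords-long full (λ _ → ℕ.≤-refl) (n*[1+σ]<n+[1+σ*n+i] σ n i)) ⟩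
  sumBelow (suc (σ * n)) (λ i → words (n + i))
    ≡⟨ sumBelow-cong (suc (σ * n)) (λ i _ → sym (S2≡acceptedWords {n} (suc σ) (n + i))) ⟩
  sumBelow (suc (σ * n)) (λ i → S2 (suc σ) (n + i) n)
    ≡⟨ sumFromTo≡sumBelow n (σ * n) (λ k → S2 (suc σ) k n) ⟨
  sumFromTo n (suc σ * n) (λ k → S2 (suc σ) k n) ∎
  where
  open ≡-Reasoning
  open Game σ n
  full : Fin n → ℕ
  full _ = suc σ
  words : ℕ → ℕ
  words k = acceptedWords k 0 full
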